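{- Let $p$ be an odd prime, $\Omega_p$ an algebraic closure of $\mathbb{F}_p$, $P,Q\in\Omega_p\setminus\{0\}$ with $D=P^2-4Q\neq 0$, and let $r$ be a positive integer coprime to $p$. Then the following are equivalent: (i) there exist $P_r,Q_r\in\Omega_p$ such that $P=V_r(P_r,Q_r)$, $Q=Q_r^r$ and $\frac{P_r^2}{Q_r}\in\mathbb{F}_p$; (ii) there exists $x\in\mathbb{F}_p$ such that $V_r(x,1)=\frac{P^2}{Q}-2$.
   Context: For $P,Q$ in a field, the Lucas sequence $V_n(P,Q)$ is defined by $V_0=2$, $V_1=P$, $V_{n+2}=PV_{n+1}-QV_n$. -}

module Defs where

open import Level using (Level; _⊔_) renaming (suc to lsuc)
open import Data.Nat using (ℕ; zero; suc)
open import Data.List using (List; []; _∷_; _++_; [_]; map)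
open import Data.Product using (∃; Σ; _×_; _,_)
open import Relation.Nullary using (¬_)
open import Algebra.Bundles using (CommutativeRing)

-- A field: a nontrivial commutative ring with a multiplicative inverse
-- operation on nonzero elements (the value of 0⁻¹ is irrelevant).
record Field (c ℓ : Level) : Set (lsuc (c ⊔ ℓ)) where
  field
    commutativeRing : CommutativeRing c ℓ
  open CommutativeRing commutativeRing public
  field
    _⁻¹ : Carrier → Carrier
    1≉0 : ¬ (1# ≈ 0#)
    ⁻¹-inverse : ∀ x → ¬ (x ≈ 0#) → (x * x ⁻¹) ≈ 1#

module FieldOps {c ℓ} (K : Field c ℓ) where
  open Field K

  fromℕ : ℕ → Carrier
  fromℕ zero    = 0#
  fromℕ (suc n) = 1# + fromℕ n

  pow : Carrier → ℕ → Carrier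
  pow x zero    = 1#
  pow x (suc n) = x * pow x n

  _/_ : Carrier → Carrier → Carrier
  x / y = x * (y ⁻¹)

  -- evaluation of a polynomial given by its coefficient list [a₀, a₁, …]
  eval : List Carrier → Carrier → Carrier
  eval []       x = 0#
  eval (a ∷ as) x = a + x * eval as x

  InPrimeField : Carrier → Set ℓ
  InPrimeField x = ∃ λ (n : ℕ) → x ≈ fromℕ n

  V : ℕ → Carrier → Carrier → Carrier
  V zero          P Q = 1# + 1#
  V (suc zero)    P Q = P
  V (suc (suc n)) P Q = (P * V (suc n) P Q) - (Q * V n P Q)

record IsAlgebraicClosureOfFp {c ℓ} (p : ℕ) (K : Field c ℓ) : Set (c ⊔ ℓ) where
  open Field K
  open FieldOps K
  field
    characteristic : fromℕ p ≈ 0#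
    -- every monic polynomial of degree ≥ 1 has a root
    algClosed : ∀ (a : Carrier) (as : List Carrier) →
                ∃ λ x → eval ((a ∷ as) ++ [ 1# ]) x ≈ 0#
    -- every element is a root of a monic polynomial with coefficients in 𝔽_p
    algebraic : ∀ (x : Carrier) →
                ∃ λ (ns : List ℕ) → eval (map fromℕ ns ++ [ 1# ]) x ≈ 0#

{-# OPTIONS --safe #-}
module Submission where

-- Writing c = P_r²/Q_r, one has V_r(P_r, Q_r)² = Q_r^r (V_r(c − 2, 1) + 2): this
-- follows from V_r(P, Q)² = V_{2r}(P, Q) + 2Q^r, V_{2r}(P, Q) = V_r(P² − 2Q, Q²),
-- the homogeneity V_r(aP, a²Q) = a^r V_r(P, Q) and P_r² − 2Q_r = Q_r(c − 2).
-- So (i) gives (ii) with x = c − 2. Conversely, given x, choose Q₀ with Q₀^r = Q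
-- and P₀ with P₀² = (x + 2)Q₀ in Ω; then V_r(P₀, Q₀)² = P². The ratio
-- s = P / V_r(P₀, Q₀) squares to 1, so rescaling (P₀, Q₀) to (aP₀, a²Q₀) with
-- a^r = s turns V_r into P without changing Q₀^r or P₀²/Q₀.

open import Defs
open import Level using (Level; _⊔_)
open import Data.Nat as ℕ using (ℕ; zero; suc; _<_)
import Data.Nat.Properties as ℕ
open import Data.Nat.Primality using (Prime)
open import Data.Nat.Divisibility using (_∣_)
open import Data.Nat.Coprimality using (Coprime)
open import Data.Integer as ℤ using (ℤ; +_; -[1+_]; _⊖_; sign; ∣_∣; _◃_)
import Data.Integer.Properties as ℤ
open import Data.Sign as Sign using (Sign)
open import Data.List using (_++_; [_]; replicate)
open import Data.Maybe using (Maybe; just; nothing)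
open import Data.Product using (∃; ∃₂; _×_; _,_; proj₁; proj₂)
open import Function.Bundles using (_⇔_; mk⇔)
open import Relation.Nullary using (¬_; yes; no)
open import Relation.Binary.PropositionalEquality as ≡ using (_≡_)
open import Algebra.Bundles using (CommutativeRing)
open import Algebra.Solver.Ring.AlmostCommutativeRing
  using (fromCommutativeRing; _-Raw-AlmostCommutative⟶_)
import Algebra.Solver.Ring
import Algebra.Properties.Ring
import Algebra.Properties.Semiring.Mult
import Algebra.Properties.AbelianGroup
import Algebra.Properties.CommutativeSemigroup
import Relation.Binary.Reasoning.Setoid

-- Integer coefficients are needed so that identities involving cancellation,
-- such as (x + y) − y ≈ x, normalise to syntactically equal polynomials.
module IntegerCoefficientSolver {c ℓ} (R : CommutativeRing c ℓ) where
  open CommutativeRing R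
  open Algebra.Properties.Ring ring using (-‿involutive; -0#≈0#; -1*x≈-x)
  open Algebra.Properties.Semiring.Mult semiring using (×-homo-+; ×1-homo-*) renaming (_×_ to _·_)
  open Algebra.Properties.AbelianGroup +-abelianGroup using (⁻¹-∙-comm)
  open Algebra.Properties.CommutativeSemigroup *-commutativeSemigroup using () renaming (interchange to *-interchange)
  open Algebra.Properties.CommutativeSemigroup +-commutativeSemigroup using () renaming (interchange to +-interchange)
  open Relation.Binary.Reasoning.Setoid setoid

  ⟦_⟧ᶻ : ℤ → Carrier
  ⟦ + n     ⟧ᶻ = n · 1#
  ⟦ -[1+ n ] ⟧ᶻ = - (suc n · 1#)

  ⟦_⟧ˢ : Sign → Carrier
  ⟦ Sign.+ ⟧ˢ = 1#
  ⟦ Sign.- ⟧ˢ = - 1#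

  ⟦⟧ᶻ-sign-abs : ∀ i → ⟦ i ⟧ᶻ ≈ ⟦ sign i ⟧ˢ * (∣ i ∣ · 1#)
  ⟦⟧ᶻ-sign-abs (+ n)     = sym (*-identityˡ _)
  ⟦⟧ᶻ-sign-abs -[1+ n ] = sym (-1*x≈-x _)

  ⟦⟧ᶻ-◃ : ∀ s n → ⟦ s ◃ n ⟧ᶻ ≈ ⟦ s ⟧ˢ * (n · 1#)
  ⟦⟧ᶻ-◃ s        zero    = sym (zeroʳ _)
  ⟦⟧ᶻ-◃ Sign.+ (suc n) = sym (*-identityˡ _)
  ⟦⟧ᶻ-◃ Sign.- (suc n) = sym (-1*x≈-x _)

  ⟦⟧ˢ-homo-* : ∀ s t → ⟦ s Sign.* t ⟧ˢ ≈ ⟦ s ⟧ˢ * ⟦ t ⟧ˢ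
  ⟦⟧ˢ-homo-* Sign.+ t      = sym (*-identityˡ _)
  ⟦⟧ˢ-homo-* Sign.- Sign.+ = sym (*-identityʳ _)
  ⟦⟧ˢ-homo-* Sign.- Sign.- = sym (trans (-1*x≈-x _) (-‿involutive 1#))

  ⟦⟧ᶻ-homo-⊖ : ∀ m n → ⟦ m ⊖ n ⟧ᶻ ≈ m · 1# - n · 1#
  ⟦⟧ᶻ-homo-⊖ m       zero    = trans (sym (+-identityʳ _)) (+-congˡ (sym -0#≈0#))
  ⟦⟧ᶻ-homo-⊖ zero    (suc n) = sym (+-identityˡ _)
  ⟦⟧ᶻ-homo-⊖ (suc m) (suc n) = begin
    ⟦ suc m ⊖ suc n ⟧ᶻ          ≡⟨ ≡.cong ⟦_⟧ᶻ (ℤ.[1+m]⊖[1+n]≡m⊖n m n) ⟩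
    ⟦ m ⊖ n ⟧ᶻ                  ≈⟨ ⟦⟧ᶻ-homo-⊖ m n ⟩
    m · 1# - n · 1#             ≈⟨ +-identityˡ _ ⟨
    0# + (m · 1# - n · 1#)      ≈⟨ +-congʳ (-‿inverseʳ 1#) ⟨
    (1# - 1#) + (m · 1# - n · 1#) ≈⟨ +-interchange 1# (- 1#) _ _ ⟩
    (1# + m · 1#) + (- 1# - n · 1#) ≈⟨ +-congˡ (⁻¹-∙-comm 1# _) ⟩
    (1# + m · 1#) - (1# + n · 1#) ∎

  ⟦⟧ᶻ-homo-+ : ∀ i j → ⟦ i ℤ.+ j ⟧ᶻ ≈ ⟦ i ⟧ᶻ + ⟦ j ⟧ᶻ
  ⟦⟧ᶻ-homo-+ (+ m)     (+ n)     = ×-homo-+ 1# m n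
  ⟦⟧ᶻ-homo-+ (+ m)     -[1+ n ] = ⟦⟧ᶻ-homo-⊖ m (suc n)
  ⟦⟧ᶻ-homo-+ -[1+ m ] (+ n)     = trans (⟦⟧ᶻ-homo-⊖ n (suc m)) (+-comm _ _)
  ⟦⟧ᶻ-homo-+ -[1+ m ] -[1+ n ] = begin
    - (suc (suc (m ℕ.+ n)) · 1#) ≡⟨ ≡.cong (λ k → - (k · 1#)) (ℕ.+-suc (suc m) n) ⟨
    - ((suc m ℕ.+ suc n) · 1#)   ≈⟨ -‿cong (×-homo-+ 1# (suc m) (suc n)) ⟩
    - (suc m · 1# + suc n · 1#)  ≈⟨ ⁻¹-∙-comm _ _ ⟨
    - (suc m · 1#) - suc n · 1#  ∎

  ⟦⟧ᶻ-homo-* : ∀ i j → ⟦ i ℤ.* j ⟧ᶻ ≈ ⟦ i ⟧ᶻ * ⟦ j ⟧ᶻ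
  ⟦⟧ᶻ-homo-* i j = begin
    ⟦ (sign i Sign.* sign j) ◃ (∣ i ∣ ℕ.* ∣ j ∣) ⟧ᶻ
      ≈⟨ ⟦⟧ᶻ-◃ (sign i Sign.* sign j) (∣ i ∣ ℕ.* ∣ j ∣) ⟩
    ⟦ sign i Sign.* sign j ⟧ˢ * ((∣ i ∣ ℕ.* ∣ j ∣) · 1#)
      ≈⟨ *-cong (⟦⟧ˢ-homo-* (sign i) (sign j)) (×1-homo-* ∣ i ∣ ∣ j ∣) ⟩
    (⟦ sign i ⟧ˢ * ⟦ sign j ⟧ˢ) * (∣ i ∣ · 1# * ∣ j ∣ · 1#)
      ≈⟨ *-interchange _ _ _ _ ⟩
    (⟦ sign i ⟧ˢ * ∣ i ∣ · 1#) * (⟦ sign j ⟧ˢ * ∣ j ∣ · 1#)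
      ≈⟨ *-cong (⟦⟧ᶻ-sign-abs i) (⟦⟧ᶻ-sign-abs j) ⟨
    ⟦ i ⟧ᶻ * ⟦ j ⟧ᶻ ∎

  ⟦⟧ᶻ-homo-neg : ∀ i → ⟦ ℤ.- i ⟧ᶻ ≈ - ⟦ i ⟧ᶻ
  ⟦⟧ᶻ-homo-neg (+ zero)  = sym -0#≈0#
  ⟦⟧ᶻ-homo-neg (+ suc n) = refl
  ⟦⟧ᶻ-homo-neg -[1+ n ] = sym (-‿involutive _)

  ⟦⟧ᶻ-morphism : ℤ.+-*-rawRing -Raw-AlmostCommutative⟶ fromCommutativeRing R
  ⟦⟧ᶻ-morphism = record
    { ⟦_⟧    = ⟦_⟧ᶻ
    ; +-homo = ⟦⟧ᶻ-homo-+
    ; *-homo = ⟦⟧ᶻ-homo-*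
    ; -‿homo = ⟦⟧ᶻ-homo-neg
    ; 0-homo = refl
    ; 1-homo = +-identityʳ 1#
    }

  ⟦⟧ᶻ-≟ : ∀ i j → Maybe (⟦ i ⟧ᶻ ≈ ⟦ j ⟧ᶻ)
  ⟦⟧ᶻ-≟ i j with i ℤ.≟ j
  ... | yes ≡.refl = just refl
  ... | no _       = nothing

  open Algebra.Solver.Ring ℤ.+-*-rawRing (fromCommutativeRing R) ⟦⟧ᶻ-morphism ⟦⟧ᶻ-≟ public
    using (solve; _:=_; _:+_; _:*_; :-_; _:-_)


module FieldProperties {ℓ₁ ℓ₂} (K : Field ℓ₁ ℓ₂) where
  open Field K
  open FieldOps K
  open IntegerCoefficientSolver commutativeRing using (solve; _:=_; _:+_; _:*_; :-_; _:-_)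
  open Algebra.Properties.CommutativeSemigroup *-commutativeSemigroup using (interchange)
  open Relation.Binary.Reasoning.Setoid setoid

  two : Carrier
  two = 1# + 1#

  two*x≈x+x : ∀ x → two * x ≈ x + x
  two*x≈x+x x = trans (distribʳ x 1# 1#) (+-cong (*-identityˡ x) (*-identityˡ x))

  x*two≈x+x : ∀ x → x * two ≈ x + x
  x*two≈x+x x = trans (*-comm x two) (two*x≈x+x x)

  ⁻¹-inverseˡ : ∀ x → ¬ (x ≈ 0#) → x ⁻¹ * x ≈ 1#
  ⁻¹-inverseˡ x x≉0 = trans (*-comm _ _) (⁻¹-inverse x x≉0)

  *-nonzero : ∀ {x y} → ¬ (x ≈ 0#) → ¬ (y ≈ 0#) → ¬ (x * y ≈ 0#)
  *-nonzero {x} {y} x≉0 y≉0 xy≈0 = y≉0 (begin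
    y                ≈⟨ *-identityˡ y ⟨
    1# * y           ≈⟨ *-congʳ (⁻¹-inverseˡ x x≉0) ⟨
    (x ⁻¹ * x) * y   ≈⟨ *-assoc _ _ _ ⟩
    x ⁻¹ * (x * y)   ≈⟨ *-congˡ xy≈0 ⟩
    x ⁻¹ * 0#        ≈⟨ zeroʳ _ ⟩
    0#               ∎)

  pow-zeroˡ : ∀ {x} n → x ≈ 0# → pow x (suc n) ≈ 0#
  pow-zeroˡ n x≈0 = trans (*-congʳ x≈0) (zeroˡ _)

  pow-distrib-* : ∀ x y n → pow (x * y) n ≈ pow x n * pow y n
  pow-distrib-* x y zero    = sym (*-identityˡ 1#)
  pow-distrib-* x y (suc n) = trans (*-congˡ (pow-distrib-* x y n)) (interchange x y _ _)

  /-*-cancel : ∀ {z} y → ¬ (z ≈ 0#) → (y / z) * z ≈ y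
  /-*-cancel {z} y z≉0 = begin
    (y * z ⁻¹) * z ≈⟨ *-assoc _ _ _ ⟩
    y * (z ⁻¹ * z) ≈⟨ *-congˡ (⁻¹-inverseˡ z z≉0) ⟩
    y * 1#         ≈⟨ *-identityʳ y ⟩
    y              ∎

  /-unique : ∀ {y z c} → ¬ (z ≈ 0#) → y ≈ c * z → y / z ≈ c
  /-unique {y} {z} {c} z≉0 y≈cz = begin
    y * z ⁻¹       ≈⟨ *-congʳ y≈cz ⟩
    (c * z) * z ⁻¹ ≈⟨ *-assoc _ _ _ ⟩
    c * (z * z ⁻¹) ≈⟨ *-congˡ (⁻¹-inverse z z≉0) ⟩
    c * 1#         ≈⟨ *-identityʳ c ⟩
    c              ∎

  fromℕ-+ : ∀ m n → fromℕ (m ℕ.+ n) ≈ fromℕ m + fromℕ n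
  fromℕ-+ zero    n = sym (+-identityˡ _)
  fromℕ-+ (suc m) n = trans (+-congˡ (fromℕ-+ m n)) (sym (+-assoc _ _ _))

  InPrimeField-resp : ∀ {x y} → x ≈ y → InPrimeField x → InPrimeField y
  InPrimeField-resp x≈y (n , x≈n) = n , trans (sym x≈y) x≈n

  InPrimeField-+two : ∀ {x} → InPrimeField x → InPrimeField (x + two)
  InPrimeField-+two {x} (n , x≈n) = n ℕ.+ 2 , (begin
    x + two                  ≈⟨ +-cong x≈n (+-congˡ (sym (+-identityʳ 1#))) ⟩
    fromℕ n + fromℕ 2        ≈⟨ fromℕ-+ n 2 ⟨
    fromℕ (n ℕ.+ 2)          ∎)

  -- In characteristic 1 + j the element −2 is the image of j + j.
  InPrimeField-−two : ∀ j → fromℕ (suc j) ≈ 0# → ∀ {x} → InPrimeField x → InPrimeField (x - two)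
  InPrimeField-−two j char {x} (n , x≈n) = n ℕ.+ (j ℕ.+ j) , (begin
    x - two                  ≈⟨ solve 2 (λ x o → x :- (o :+ o) := x :+ (:- o :+ :- o)) refl x 1# ⟩
    x + (- 1# + - 1#)        ≈⟨ +-cong x≈n (+-cong (sym j≈-1) (sym j≈-1)) ⟩
    fromℕ n + (fromℕ j + fromℕ j)
                             ≈⟨ trans (fromℕ-+ n _) (+-congˡ (fromℕ-+ j j)) ⟨
    fromℕ (n ℕ.+ (j ℕ.+ j)) ∎)
    where
    j≈-1 : fromℕ j ≈ - 1#
    j≈-1 = begin
      fromℕ j                  ≈⟨ solve 2 (λ y o → y := :- o :+ (o :+ y)) refl (fromℕ j) 1# ⟩
      - 1# + (1# + fromℕ j)    ≈⟨ +-congˡ char ⟩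
      - 1# + 0#                ≈⟨ +-identityʳ _ ⟩
      - 1#                     ∎

  module _ {p} (closure : IsAlgebraicClosureOfFp p K) where
    open IsAlgebraicClosureOfFp closure using (algClosed)

    eval-monomial : ∀ k y → eval (replicate k 0# ++ [ 1# ]) y ≈ pow y k
    eval-monomial zero    y = trans (+-congˡ (zeroʳ y)) (+-identityʳ 1#)
    eval-monomial (suc k) y = trans (+-identityˡ _) (*-congˡ (eval-monomial k y))

    pow-suc-surjective : ∀ k s → ∃ λ y → pow y (suc k) ≈ s
    pow-suc-surjective k s with algClosed (- s) (replicate k 0#)
    ... | y , root = y , (begin
      pow y (suc k)                ≈⟨ solve 2 (λ x s → x := (:- s :+ x) :+ s) refl (pow y (suc k)) s ⟩
      (- s + pow y (suc k)) + s    ≈⟨ +-congʳ (+-congˡ (*-congˡ (eval-monomial k y))) ⟨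
      (- s + y * eval (replicate k 0# ++ [ 1# ]) y) + s ≈⟨ +-congʳ root ⟩
      0# + s                       ≈⟨ +-identityˡ s ⟩
      s                            ∎)

    sign-correction : ∀ k {U P} → ¬ (P ≈ 0#) → U * U ≈ P * P →
      ∃ λ a → (pow a (suc k) * U ≈ P) × (pow a (suc k) * pow a (suc k) ≈ 1#)
    sign-correction k {U} {P} P≉0 U²≈P² =
      a , trans (*-congʳ aʳ≈s) (/-*-cancel P U≉0) , trans (*-cong aʳ≈s aʳ≈s) s²≈1
      where
      U≉0 : ¬ (U ≈ 0#)
      U≉0 U≈0 = *-nonzero P≉0 P≉0 (trans (sym U²≈P²) (trans (*-congʳ U≈0) (zeroˡ U)))
      s = P / U
      s²≈1 : s * s ≈ 1#
      s²≈1 = begin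
        (P * U ⁻¹) * (P * U ⁻¹)     ≈⟨ interchange _ _ _ _ ⟩
        (P * P) * (U ⁻¹ * U ⁻¹)     ≈⟨ *-congʳ U²≈P² ⟨
        (U * U) * (U ⁻¹ * U ⁻¹)     ≈⟨ interchange _ _ _ _ ⟩
        (U * U ⁻¹) * (U * U ⁻¹)     ≈⟨ *-cong (⁻¹-inverse U U≉0) (⁻¹-inverse U U≉0) ⟩
        1# * 1#                     ≈⟨ *-identityˡ 1# ⟩
        1#                          ∎
      a = proj₁ (pow-suc-surjective k s)
      aʳ≈s = proj₂ (pow-suc-surjective k s)

double : ℕ → ℕ
double zero    = zero
double (suc n) = suc (suc (double n))

module LucasSequences {ℓ₁ ℓ₂} (K : Field ℓ₁ ℓ₂) where
  open Field K
  open FieldOps K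
  open FieldProperties K
  open IntegerCoefficientSolver commutativeRing using (solve; _:=_; _:+_; _:*_; :-_; _:-_)
  open Algebra.Properties.CommutativeSemigroup *-commutativeSemigroup using (interchange)
  open Relation.Binary.Reasoning.Setoid setoid

  V-cong : ∀ n {P P′ Q Q′} → P ≈ P′ → Q ≈ Q′ → V n P Q ≈ V n P′ Q′
  V-cong zero          P≈P′ Q≈Q′ = refl
  V-cong (suc zero)    P≈P′ Q≈Q′ = P≈P′
  V-cong (suc (suc n)) P≈P′ Q≈Q′ =
    +-cong (*-cong P≈P′ (V-cong (suc n) P≈P′ Q≈Q′)) (-‿cong (*-cong Q≈Q′ (V-cong n P≈P′ Q≈Q′)))

  negDisc : Carrier → Carrier → Carrier
  negDisc P Q = ((Q + Q) + (Q + Q)) - P * P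

  V-cassini : ∀ P Q n →
    V (suc n) P Q * V (suc n) P Q ≈ V n P Q * V (suc (suc n)) P Q + pow Q n * negDisc P Q
  V-cassini P Q zero = sym (begin
    two * (P * P - Q * two) + 1# * negDisc P Q
      ≈⟨ +-cong (two*x≈x+x _) (*-identityˡ _) ⟩
    (P * P - Q * two) + (P * P - Q * two) + negDisc P Q
      ≈⟨ +-congʳ (+-cong P²-2Q P²-2Q) ⟩
    (P * P - (Q + Q)) + (P * P - (Q + Q)) + negDisc P Q
      ≈⟨ solve 2 (λ P Q → ((P :* P :- (Q :+ Q)) :+ (P :* P :- (Q :+ Q)))
                            :+ (((Q :+ Q) :+ (Q :+ Q)) :- P :* P) := P :* P) refl P Q ⟩
    P * P ∎)
    where
    P²-2Q : P * P - Q * two ≈ P * P - (Q + Q)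
    P²-2Q = +-congˡ (-‿cong (x*two≈x+x Q))
  V-cassini P Q (suc n) = begin
    d * d
      ≈⟨ solve 4 (λ P Q a b → (P :* b :- Q :* a) :* (P :* b :- Q :* a) :=
           b :* (P :* (P :* b :- Q :* a) :- Q :* b) :+ Q :* (b :* b) :- Q :* (a :* (P :* b :- Q :* a)))
           refl P Q a b ⟩
    b * (P * d - Q * b) + Q * (b * b) - Q * (a * d)
      ≈⟨ +-congʳ (+-congˡ (*-congˡ (V-cassini P Q n))) ⟩
    b * (P * d - Q * b) + Q * (a * d + q * negDisc P Q) - Q * (a * d)
      ≈⟨ solve 7 (λ P Q b d ad q k → b :* (P :* d :- Q :* b) :+ Q :* (ad :+ q :* k) :- Q :* ad :=
           b :* (P :* d :- Q :* b) :+ (Q :* q) :* k) refl P Q b d (a * d) q (negDisc P Q) ⟩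
    b * (P * d - Q * b) + (Q * q) * negDisc P Q ∎
    where
    a = V n P Q
    b = V (suc n) P Q
    d = V (suc (suc n)) P Q
    q = pow Q n

  private
    isolateˡ : ∀ {x y z} → x ≈ y + z → y ≈ x - z
    isolateˡ {x} {y} {z} x≈y+z =
      trans (solve 2 (λ y z → y := (y :+ z) :- z) refl y z) (+-congʳ (sym x≈y+z))

  V-duplication : ∀ P Q n →
    (V n P Q * V n P Q ≈ V (double n) P Q + (pow Q n + pow Q n)) ×
    (V n P Q * V (suc n) P Q ≈ V (suc (double n)) P Q + P * pow Q n)
  V-duplication P Q zero =
    two*x≈x+x two , trans (two*x≈x+x P) (+-congˡ (sym (*-identityʳ P)))
  V-duplication P Q (suc n) = b² , bd
    where
    a = V n P Q
    b = V (suc n) P Q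
    d = V (suc (suc n)) P Q
    e = V (double n) P Q
    f = V (suc (double n)) P Q
    q = pow Q n
    a²≈e+2q = proj₁ (V-duplication P Q n)
    ab≈f+Pq = proj₂ (V-duplication P Q n)
    b² : b * b ≈ (P * f - Q * e) + (Q * q + Q * q)
    b² = sym (begin
      (P * f - Q * e) + (Q * q + Q * q)
        ≈⟨ +-congʳ (+-cong (*-congˡ (isolateˡ ab≈f+Pq)) (-‿cong (*-congˡ (isolateˡ a²≈e+2q)))) ⟩
      (P * (a * b - P * q) - Q * (a * a - (q + q))) + (Q * q + Q * q)
        ≈⟨ solve 5 (λ P Q a b q →
             (P :* (a :* b :- P :* q) :- Q :* (a :* a :- (q :+ q))) :+ (Q :* q :+ Q :* q) :=
             a :* (P :* b :- Q :* a) :+ q :* (((Q :+ Q) :+ (Q :+ Q)) :- P :* P)) refl P Q a b q ⟩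
      a * (P * b - Q * a) + q * negDisc P Q ≈⟨ V-cassini P Q n ⟨
      b * b ∎)
    bd : b * d ≈ (P * (P * f - Q * e) - Q * f) + P * (Q * q)
    bd = sym (begin
      (P * (P * f - Q * e) - Q * f) + P * (Q * q)
        ≈⟨ +-congʳ (+-cong (*-congˡ (isolateˡ b²)) (-‿cong (*-congˡ (isolateˡ ab≈f+Pq)))) ⟩
      (P * (b * b - (Q * q + Q * q)) - Q * (a * b - P * q)) + P * (Q * q)
        ≈⟨ solve 5 (λ P Q a b q →
             (P :* (b :* b :- (Q :* q :+ Q :* q)) :- Q :* (a :* b :- P :* q)) :+ P :* (Q :* q) :=
             b :* (P :* b :- Q :* a)) refl P Q a b q ⟩
      b * d ∎)

  V-sq : ∀ P Q n → V n P Q * V n P Q ≈ V (double n) P Q + (pow Q n + pow Q n)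
  V-sq P Q n = proj₁ (V-duplication P Q n)

  V-even : ∀ P Q n → V (double n) P Q ≈ V n (P * P - (Q + Q)) (Q * Q)
  V-even P Q zero          = refl
  V-even P Q (suc zero)    = +-congˡ (-‿cong (x*two≈x+x Q))
  V-even P Q (suc (suc n)) = trans (V-step-two (double n))
    (+-cong (*-congˡ (V-even P Q (suc n))) (-‿cong (*-congˡ (V-even P Q n))))
    where
    V-step-two : ∀ m → V (4 ℕ.+ m) P Q ≈ (P * P - (Q + Q)) * V (2 ℕ.+ m) P Q - (Q * Q) * V m P Q
    V-step-two m = solve 4 (λ P Q a b →
        P :* (P :* (P :* b :- Q :* a) :- Q :* b) :- Q :* (P :* b :- Q :* a) :=
        (P :* P :- (Q :+ Q)) :* (P :* b :- Q :* a) :- (Q :* Q) :* a) refl P Q (V m P Q) (V (suc m) P Q)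

  V-homogeneous : ∀ n a P Q → V n (a * P) ((a * a) * Q) ≈ pow a n * V n P Q
  V-homogeneous zero          a P Q = sym (*-identityˡ _)
  V-homogeneous (suc zero)    a P Q = *-congʳ (sym (*-identityʳ a))
  V-homogeneous (suc (suc n)) a P Q = begin
    (a * P) * V (suc n) (a * P) ((a * a) * Q) - ((a * a) * Q) * V n (a * P) ((a * a) * Q)
      ≈⟨ +-cong (*-congˡ (V-homogeneous (suc n) a P Q)) (-‿cong (*-congˡ (V-homogeneous n a P Q))) ⟩
    (a * P) * ((a * w) * y) - ((a * a) * Q) * (w * x)
      ≈⟨ solve 6 (λ a P Q w x y →
           (a :* P) :* ((a :* w) :* y) :- ((a :* a) :* Q) :* (w :* x) :=
           (a :* (a :* w)) :* (P :* y :- Q :* x)) refl a P Q w x y ⟩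
    (a * (a * w)) * (P * y - Q * x) ∎
    where
    w = pow a n
    x = V n P Q
    y = V (suc n) P Q

  V-sq-normalise : ∀ r P Q c → P * P ≈ c * Q →
    V r P Q * V r P Q ≈ pow Q r * (V r (c - two) 1# + two)
  V-sq-normalise r P Q c P²≈cQ = begin
    V r P Q * V r P Q                         ≈⟨ V-sq P Q r ⟩
    V (double r) P Q + (q + q)                ≈⟨ +-congʳ (V-even P Q r) ⟩
    V r (P * P - (Q + Q)) (Q * Q) + (q + q)   ≈⟨ +-congʳ (V-cong r P²-2Q (sym (*-identityʳ _))) ⟩
    V r (Q * (c - two)) ((Q * Q) * 1#) + (q + q) ≈⟨ +-congʳ (V-homogeneous r Q (c - two) 1#) ⟩
    q * W + (q + q)                           ≈⟨ +-congˡ (x*two≈x+x q) ⟨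
    q * W + q * two                           ≈⟨ distribˡ q W two ⟨
    q * (W + two)                             ∎
    where
    q = pow Q r
    W = V r (c - two) 1#
    P²-2Q : P * P - (Q + Q) ≈ Q * (c - two)
    P²-2Q = begin
      P * P - (Q + Q) ≈⟨ +-cong P²≈cQ (-‿cong (sym (x*two≈x+x Q))) ⟩
      c * Q - Q * two ≈⟨ solve 3 (λ c Q t → c :* Q :- Q :* t := Q :* (c :- t)) refl c Q two ⟩
      Q * (c - two)   ∎

  LucasRootOverFp : ℕ → Carrier → Carrier → Set (ℓ₁ ⊔ ℓ₂)
  LucasRootOverFp r P Q = ∃₂ λ (Pr Qr : Carrier) →
    (P ≈ V r Pr Qr) × (Q ≈ pow Qr r) × InPrimeField ((Pr * Pr) / Qr)

  NormalisedTraceOverFp : ℕ → Carrier → Carrier → Set (ℓ₁ ⊔ ℓ₂)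
  NormalisedTraceOverFp r P Q = ∃ λ (x : Carrier) → InPrimeField x × (V r x 1# ≈ ((P * P) / Q) - two)

  root⇒normalisedTrace : ∀ j → fromℕ (suc j) ≈ 0# → ∀ {P Q} → ¬ (Q ≈ 0#) →
    ∀ k → LucasRootOverFp (suc k) P Q → NormalisedTraceOverFp (suc k) P Q
  root⇒normalisedTrace j char {P} {Q} Q≉0 k (Pr , Qr , P≈V , Q≈Qrʳ , c∈Fp) =
    c - two , InPrimeField-−two j char c∈Fp , W≈P²/Q-2
    where
    r = suc k
    c = (Pr * Pr) / Qr
    W = V r (c - two) 1#
    Qr≉0 : ¬ (Qr ≈ 0#)
    Qr≉0 Qr≈0 = Q≉0 (trans Q≈Qrʳ (pow-zeroˡ k Qr≈0))
    P²≈[W+2]Q : P * P ≈ (W + two) * Q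
    P²≈[W+2]Q = begin
      P * P                 ≈⟨ *-cong P≈V P≈V ⟩
      V r Pr Qr * V r Pr Qr ≈⟨ V-sq-normalise r Pr Qr c (sym (/-*-cancel (Pr * Pr) Qr≉0)) ⟩
      pow Qr r * (W + two)  ≈⟨ *-comm _ _ ⟩
      (W + two) * pow Qr r  ≈⟨ *-congˡ Q≈Qrʳ ⟨
      (W + two) * Q         ∎
    W≈P²/Q-2 : W ≈ (P * P) / Q - two
    W≈P²/Q-2 = begin
      W                     ≈⟨ solve 2 (λ w t → w := (w :+ t) :- t) refl W two ⟩
      (W + two) - two       ≈⟨ +-congʳ (/-unique Q≉0 P²≈[W+2]Q) ⟨
      (P * P) / Q - two     ∎

  rescale-root : ∀ k {P Q Pr Qr a c} → ¬ (Q ≈ 0#) → InPrimeField c → Pr * Pr ≈ c * Qr →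
    Q ≈ pow Qr (suc k) → pow a (suc k) * V (suc k) Pr Qr ≈ P → pow a (suc k) * pow a (suc k) ≈ 1# →
    LucasRootOverFp (suc k) P Q
  rescale-root k {P} {Q} {Pr} {Qr} {a} {c} Q≉0 c∈Fp Pr²≈cQr Q≈Qrʳ aʳV≈P aʳ²≈1 =
    a * Pr , (a * a) * Qr , P≈V , Q≈Qr′ʳ , InPrimeField-resp (sym ratio≈c) c∈Fp
    where
    r = suc k
    P≈V : P ≈ V r (a * Pr) ((a * a) * Qr)
    P≈V = sym (trans (V-homogeneous r a Pr Qr) aʳV≈P)
    Q≈Qr′ʳ : Q ≈ pow ((a * a) * Qr) r
    Q≈Qr′ʳ = sym (begin
      pow ((a * a) * Qr) r            ≈⟨ pow-distrib-* (a * a) Qr r ⟩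
      pow (a * a) r * pow Qr r        ≈⟨ *-cong (pow-distrib-* a a r) (sym Q≈Qrʳ) ⟩
      (pow a r * pow a r) * Q         ≈⟨ *-congʳ aʳ²≈1 ⟩
      1# * Q                          ≈⟨ *-identityˡ Q ⟩
      Q                               ∎)
    a≉0 : ¬ (a ≈ 0#)
    a≉0 a≈0 = 1≉0 (trans (sym aʳ²≈1) (trans (*-congʳ (pow-zeroˡ k a≈0)) (zeroˡ _)))
    Qr≉0 : ¬ (Qr ≈ 0#)
    Qr≉0 Qr≈0 = Q≉0 (trans Q≈Qrʳ (pow-zeroˡ k Qr≈0))
    ratio≈c : ((a * Pr) * (a * Pr)) / ((a * a) * Qr) ≈ c
    ratio≈c = /-unique (*-nonzero (*-nonzero a≉0 a≉0) Qr≉0) (begin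
      (a * Pr) * (a * Pr)   ≈⟨ interchange _ _ _ _ ⟩
      (a * a) * (Pr * Pr)   ≈⟨ *-congˡ Pr²≈cQr ⟩
      (a * a) * (c * Qr)    ≈⟨ solve 3 (λ b c q → b :* (c :* q) := c :* (b :* q)) refl (a * a) c Qr ⟩
      c * ((a * a) * Qr)    ∎)

  module _ {p} (closure : IsAlgebraicClosureOfFp p K) where

    lucasRoot-up-to-sign : ∀ {P Q} → ¬ (Q ≈ 0#) → ∀ k → NormalisedTraceOverFp (suc k) P Q →
      ∃₂ λ Pr Qr → (V (suc k) Pr Qr * V (suc k) Pr Qr ≈ P * P) × (Q ≈ pow Qr (suc k)) ×
                   ∃ λ c → InPrimeField c × (Pr * Pr ≈ c * Qr)
    lucasRoot-up-to-sign {P} {Q} Q≉0 k (x , x∈Fp , W≈P²/Q-2) =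
      Pr , Qr , V²≈P² , sym Qrʳ≈Q , x + two , InPrimeField-+two x∈Fp , Pr²≈cQr
      where
      r = suc k
      Qr = proj₁ (pow-suc-surjective closure k Q)
      Qrʳ≈Q = proj₂ (pow-suc-surjective closure k Q)
      Pr = proj₁ (pow-suc-surjective closure 1 ((x + two) * Qr))
      Pr²≈cQr : Pr * Pr ≈ (x + two) * Qr
      Pr²≈cQr = trans (*-congˡ (sym (*-identityʳ Pr))) (proj₂ (pow-suc-surjective closure 1 ((x + two) * Qr)))
      V²≈P² : V r Pr Qr * V r Pr Qr ≈ P * P
      V²≈P² = begin
        V r Pr Qr * V r Pr Qr
          ≈⟨ V-sq-normalise r Pr Qr (x + two) Pr²≈cQr ⟩
        pow Qr r * (V r ((x + two) - two) 1# + two)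
          ≈⟨ *-cong Qrʳ≈Q (+-congʳ (trans (V-cong r x+2-2≈x refl) W≈P²/Q-2)) ⟩
        Q * (((P * P) / Q - two) + two)
          ≈⟨ *-congˡ (solve 2 (λ y t → (y :- t) :+ t := y) refl ((P * P) / Q) two) ⟩
        Q * ((P * P) / Q)
          ≈⟨ *-comm _ _ ⟩
        ((P * P) / Q) * Q
          ≈⟨ /-*-cancel (P * P) Q≉0 ⟩
        P * P ∎
        where
        x+2-2≈x : (x + two) - two ≈ x
        x+2-2≈x = solve 2 (λ x t → (x :+ t) :- t := x) refl x two

    normalisedTrace⇒root : ∀ {P Q} → ¬ (P ≈ 0#) → ¬ (Q ≈ 0#) →
      ∀ k → NormalisedTraceOverFp (suc k) P Q → LucasRootOverFp (suc k) P Q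
    normalisedTrace⇒root P≉0 Q≉0 k trace =
      let Pr , Qr , V²≈P² , Q≈Qrʳ , _ , c∈Fp , Pr²≈cQr = lucasRoot-up-to-sign Q≉0 k trace
          a , aʳV≈P , aʳ²≈1 = sign-correction closure k P≉0 V²≈P²
      in rescale-root k Q≉0 c∈Fp Pr²≈cQr Q≈Qrʳ aʳV≈P aʳ²≈1

lemma4p1 : ∀ {c ℓ : Level} (p : ℕ) → Prime p → ¬ (2 ∣ p) →
  (Ω : Field c ℓ) → IsAlgebraicClosureOfFp p Ω →
  let open Field Ω
      open FieldOps Ω
  in
  ∀ (P Q : Carrier) → ¬ (P ≈ 0#) → ¬ (Q ≈ 0#) →
  ¬ ((P * P) - (fromℕ 4 * Q) ≈ 0#) →
  ∀ (r : ℕ) → 0 < r → Coprime r p →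
  (∃₂ λ (Pr Qr : Carrier) →
      (P ≈ V r Pr Qr) × (Q ≈ pow Qr r) × InPrimeField ((Pr * Pr) / Qr))
  ⇔
  (∃ λ (x : Carrier) → InPrimeField x × (V r x 1# ≈ ((P * P) / Q) - (1# + 1#)))
lemma4p1 (suc j) _ _ Ω closure P Q P≉0 Q≉0 _ (suc k) _ _ =
  mk⇔ (root⇒normalisedTrace j (IsAlgebraicClosureOfFp.characteristic closure) Q≉0 k)
      (normalisedTrace⇒root closure P≉0 Q≉0 k)
  where open LucasSequences Ω
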